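{- Let $\Omega=(G,\mathcal{C})$ be a linear biased graph and let $T$ be a spanning tree of $G$. Let $P_1,P_2$ be two internally vertex-disjoint $(u,v)$-paths with $E(P_1)\subseteq E(T)$ and $E(P_2)\cap E(T)=\emptyset$. If for each $e\in E(P_2)$ the fundamental cycle $C(e,T)$ is balanced, then the cycle $P_1\cup P_2$ is balanced.
   Context: A theta graph consists of three cycles $C_1,C_2,C_3$ with $C_i\triangle C_j=C_k$ for distinct $i,j,k$. A biased graph $\Omega=(G,\mathcal{C})$ is a graph $G$ with a set $\mathcal{C}$ of cycles (balanced; others unbalanced) such that if two cycles of a theta graph lie in $\mathcal{C}$ so does the third. It is linear if every cycle of $G$ expressible as a symmetric difference of cycles of $\mathcal{C}$ belongs to $\mathcal{C}$. For a spanning tree $T$ and $e\notin E(T)$, $C(e,T)$ denotes the unique cycle in $T\cup\{e\}$. -}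

module Defs where

open import Data.Nat using (ℕ; zero; suc)
open import Data.Fin using (Fin; zero; suc; fromℕ; inject₁)
open import Data.Fin.Subset using (Subset; _∈_; _⊆_; _∪_; ⁅_⁆) renaming (⊥ to ∅)
open import Data.Bool using (_xor_)
open import Data.Vec using (zipWith)
open import Data.List using (List; foldr)
open import Data.List.Relation.Unary.All using (All)
open import Data.Product using (Σ; ∃; _×_; _,_)
open import Data.Sum using (_⊎_)
open import Relation.Binary.PropositionalEquality using (_≡_)
open import Relation.Nullary using (¬_)
open import Function.Definitions using (Injective)

-- A finite graph (loops and parallel edges allowed), vertices Fin n, edges Fin m.
-- Each edge has an unordered pair of end-vertices, given by ends.
record Graph : Set where
  field
    n    : ℕ
    m    : ℕ
    ends : Fin m → Fin n × Fin n

module _ (G : Graph) where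
  open Graph G

  V : Set
  V = Fin n

  E : Set
  E = Fin m

  EdgeSet : Set
  EdgeSet = Subset m

  Joins : E → V → V → Set
  Joins e x y = (ends e ≡ (x , y)) ⊎ (ends e ≡ (y , x))

  EdgesAre : ∀ {k} → EdgeSet → (Fin k → E) → Set
  EdgesAre X f = ∀ e → (e ∈ X → ∃ λ i → f i ≡ e) × ((∃ λ i → f i ≡ e) → e ∈ X)

  record Path (u v : V) : Set where
    field
      len   : ℕ
      vtx   : Fin (suc len) → V
      edg   : Fin len → E
      vtx-inj : Injective _≡_ _≡_ vtx
      start : vtx zero ≡ u
      end   : vtx (fromℕ len) ≡ v
      joins : ∀ i → Joins (edg i) (vtx (inject₁ i)) (vtx (suc i))

  PathEdges : ∀ {u v} → Path u v → EdgeSet → Set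
  PathEdges P X = EdgesAre X (Path.edg P)

  OnPath : ∀ {u v} → Path u v → V → Set
  OnPath P x = ∃ λ i → Path.vtx P i ≡ x

  -- A cycle of length k ≥ 1: a closed walk vtx 0, ..., vtx k = vtx 0 whose
  -- vertices vtx 0, ..., vtx (k-1) are distinct and whose edges are distinct.
  record CycleWalk : Set where
    field
      len₋₁ : ℕ
      vtx   : Fin (suc (suc len₋₁)) → V
      edg   : Fin (suc len₋₁) → E
      vtx-inj : Injective _≡_ _≡_ (λ i → vtx (inject₁ i))
      closed  : vtx (fromℕ (suc len₋₁)) ≡ vtx zero
      edg-inj : Injective _≡_ _≡_ edg
      joins : ∀ i → Joins (edg i) (vtx (inject₁ i)) (vtx (suc i))

  IsCycle : EdgeSet → Set
  IsCycle X = Σ CycleWalk λ W → EdgesAre X (CycleWalk.edg W)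

  _△_ : EdgeSet → EdgeSet → EdgeSet
  _△_ = zipWith _xor_

  △-sum : List EdgeSet → EdgeSet
  △-sum = foldr _△_ ∅

  record BiasedGraph : Set₁ where
    field
      Balanced : EdgeSet → Set
      balanced-cycle : ∀ C → Balanced C → IsCycle C
      theta : ∀ C₁ C₂ C₃ → IsCycle C₁ → IsCycle C₂ → IsCycle C₃ →
              C₁ △ C₂ ≡ C₃ → Balanced C₁ → Balanced C₂ → Balanced C₃

  Linear : BiasedGraph → Set
  Linear Ω = ∀ C → IsCycle C →
             (∃ λ (Cs : List EdgeSet) → All Balanced Cs × (△-sum Cs ≡ C)) →
             Balanced C
    where open BiasedGraph Ω

  IsSpanningTree : EdgeSet → Set
  IsSpanningTree T =
    (∀ x y → Σ (Path x y) λ P → ∀ i → Path.edg P i ∈ T) ×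
    (∀ C → IsCycle C → ¬ (C ⊆ T))

  -- C is the fundamental cycle C(e,T): a cycle contained in T ∪ {e}
  -- (for a spanning tree T and e ∉ T such a cycle exists and is unique).
  IsFundamentalCycle : EdgeSet → E → EdgeSet → Set
  IsFundamentalCycle T e C = IsCycle C × (C ⊆ T ∪ ⁅ e ⁆)

module Submission where

-- Read the two paths as walks A = P₁ (inside T) and D = P₂
-- (outside T).  For every edge f = xy of D let Q_f be the T-path from y
-- back to x; then f + Q_f is the fundamental cycle C(f,T), balanced by
-- hypothesis.  Working with edge sets mod 2, the symmetric difference of
-- all these cycles is D + (Q_f₁ + ... + Q_fₖ).  The walk A followed by the
-- concatenated Q's is a closed walk inside the forest T, and a closed walk
-- in a forest uses every edge an even number of times (loop erasure: a
-- simple walk in a forest can only be closed by retracing its last edge).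
-- Hence the Q's sum to E(A), the symmetric difference of the fundamental
-- cycles is E₁ ∪ E₂, and E₁ ∪ E₂ is a cycle; linearity makes it balanced.

open import Defs
open import Data.Nat using (ℕ; zero; suc)
open import Data.Fin using (Fin; zero; suc; fromℕ; inject₁; _≟_)
open import Data.Fin.Properties using (suc-injective; inject₁-injective; fromℕ≢inject₁)
open import Data.Fin.Subset using (Subset; _∈_; _∉_; _∪_; _⊆_; ⁅_⁆)
open import Data.Fin.Subset.Properties using (x∈p∪q⁺; x∈p∪q⁻; x∈⁅x⁆)
open import Data.Bool using (Bool; true; false; _xor_; _∨_)
open import Data.Bool.Properties using (xor-assoc; xor-comm; xor-same; xor-identityʳ; xor-∧-commutativeRing; ⇔→≡)
open import Data.Vec using (lookup; tabulate)
open import Data.Vec.Properties using (lookup-zipWith; lookup-replicate; lookup∘tabulate; []=⇒lookup; lookup⇒[]=)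
open import Data.Vec.Relation.Binary.Pointwise.Extensional using (ext; Pointwise-≡⇒≡)
open import Data.List using (List; []; _∷_; _++_; _∷ʳ_; reverse)
open import Data.List.Properties using (unfold-reverse)
open import Data.List.Relation.Unary.Any using (here; there)
open import Data.List.Relation.Unary.Any.Properties using (reverse⁻)
open import Data.List.Relation.Unary.All using (All; []; _∷_)
open import Data.List.Relation.Unary.All.Properties using (¬Any⇒All¬; All¬⇒¬Any)
open import Data.List.Relation.Unary.Unique.Propositional using (Unique; []; _∷_)
open import Data.List.Relation.Unary.Unique.Propositional.Properties using (Unique[x∷xs]⇒x∉xs)
open import Data.List.Relation.Binary.Permutation.Propositional using (_↭_; prep; ↭-sym; ↭-trans)
open import Data.List.Relation.Binary.Permutation.Propositional.Properties using (++⁺ˡ; shift; ↭-reverse; ∈-resp-↭)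
open import Data.List.Membership.Propositional using () renaming (_∈_ to _∈ₗ_; _∉_ to _∉ₗ_)
open import Data.List.Membership.Propositional.Properties using (∈-++⁺ˡ; ∈-++⁺ʳ; ∈-++⁻)
open import Data.Product using (Σ; ∃; _×_; _,_; proj₁; proj₂)
open import Data.Sum using (_⊎_; inj₁; inj₂)
open import Data.Unit using (⊤; tt)
open import Data.Empty using (⊥; ⊥-elim)
open import Function.Base using (_∘_)
open import Function.Bundles using (mk⇔)
open import Algebra.Bundles using (CommutativeRing)
open import Algebra.Properties.CommutativeSemigroup
  (CommutativeRing.+-commutativeSemigroup xor-∧-commutativeRing) using (interchange; xy∙z≈y∙xz)
open import Relation.Binary.Definitions using (DecidableEquality)
open import Relation.Binary.PropositionalEquality
open import Relation.Nullary using (¬_; yes; no; does)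

xor≡false⇒≡ : ∀ a b → a xor b ≡ false → a ≡ b
xor≡false⇒≡ a b eq = begin
  a                ≡⟨ sym (xor-identityʳ a) ⟩
  a xor false      ≡⟨ cong (a xor_) (sym (xor-same b)) ⟩
  a xor (b xor b)  ≡⟨ sym (xor-assoc a b b) ⟩
  (a xor b) xor b  ≡⟨ cong (_xor b) eq ⟩
  b                ∎
  where open ≡-Reasoning

∨≡xor : ∀ a b → (a ≡ true → b ≡ true → ⊥) → a ∨ b ≡ a xor b
∨≡xor false b     _    = refl
∨≡xor true  false _    = refl
∨≡xor true  true  both = ⊥-elim (both refl refl)

-- Parity of the number of occurrences of an element in a list: the list
-- read as a vector over GF(2).
module Parity {A : Set} (_≟ᴬ_ : DecidableEquality A) where

  parity : List A → A → Bool
  parity []      a = false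
  parity (b ∷ L) a = does (b ≟ᴬ a) xor parity L a

  parity-++ : ∀ L K a → parity (L ++ K) a ≡ parity L a xor parity K a
  parity-++ []      K a = refl
  parity-++ (b ∷ L) K a = trans (cong (does (b ≟ᴬ a) xor_) (parity-++ L K a))
                                (sym (xor-assoc (does (b ≟ᴬ a)) (parity L a) (parity K a)))

  parity-∉ : ∀ {L a} → a ∉ₗ L → parity L a ≡ false
  parity-∉ {[]}    a∉ = refl
  parity-∉ {b ∷ L} {a} a∉ with b ≟ᴬ a
  ... | yes refl = ⊥-elim (a∉ (here refl))
  ... | no _     = parity-∉ (λ a∈ → a∉ (there a∈))

  parity-∈ : ∀ {L a} → Unique L → a ∈ₗ L → parity L a ≡ true
  parity-∈ {b ∷ L} (b∉ ∷ _) (here refl) with b ≟ᴬ b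
  ... | yes _ = cong (true xor_) (parity-∉ (All¬⇒¬Any b∉))
  ... | no b≢b = ⊥-elim (b≢b refl)
  parity-∈ {b ∷ L} {a} (b∉ ∷ u) (there a∈) with b ≟ᴬ a
  ... | yes refl = ⊥-elim (All¬⇒¬Any b∉ a∈)
  ... | no _     = parity-∈ u a∈

  parity≡true⇒∈ : ∀ L {a} → parity L a ≡ true → a ∈ₗ L
  parity≡true⇒∈ (b ∷ L) {a} odd with b ≟ᴬ a
  ... | yes refl = here refl
  ... | no _     = there (parity≡true⇒∈ L odd)

  parity-twice : ∀ b a → parity (b ∷ b ∷ []) a ≡ false
  parity-twice b a = trans (cong (β xor_) (xor-identityʳ β)) (xor-same β)
    where β = does (b ≟ᴬ a)

module SubsetParity {k : ℕ} where
  open Parity (_≟_ {k})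

  Enumerates : List (Fin k) → Subset k → Set
  Enumerates L C = ∀ g → (g ∈ C → g ∈ₗ L) × (g ∈ₗ L → g ∈ C)

  Enumerates-++ : ∀ {L K C D} → Enumerates L C → Enumerates K D → Enumerates (L ++ K) (C ∪ D)
  Enumerates-++ {L} {K} {C} {D} enumL enumK g = into , out
    where
    into : g ∈ C ∪ D → g ∈ₗ L ++ K
    into g∈ with x∈p∪q⁻ C D g∈
    ... | inj₁ g∈C = ∈-++⁺ˡ (proj₁ (enumL g) g∈C)
    ... | inj₂ g∈D = ∈-++⁺ʳ L (proj₁ (enumK g) g∈D)
    out : g ∈ₗ L ++ K → g ∈ C ∪ D
    out g∈ with ∈-++⁻ L g∈
    ... | inj₁ g∈L = x∈p∪q⁺ (inj₁ (proj₂ (enumL g) g∈L))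
    ... | inj₂ g∈K = x∈p∪q⁺ (inj₂ (proj₂ (enumK g) g∈K))

  Enumerates-↭ : ∀ {L M C} → L ↭ M → Enumerates L C → Enumerates M C
  Enumerates-↭ L↭M enum g = (λ g∈C → ∈-resp-↭ L↭M (proj₁ (enum g) g∈C)) ,
                            (λ g∈M → proj₂ (enum g) (∈-resp-↭ (↭-sym L↭M) g∈M))

  ⟦_⟧ : List (Fin k) → Subset k
  ⟦ L ⟧ = tabulate (parity L)

  lookup-enumerated : ∀ {L C} → Unique L → Enumerates L C → ∀ g → lookup C g ≡ parity L g
  lookup-enumerated {L} {C} u enum g = ⇔→≡ (mk⇔
    (λ g∈C → parity-∈ u (proj₁ (enum g) (lookup⇒[]= g C g∈C)))
    (λ odd → []=⇒lookup (proj₂ (enum g) (parity≡true⇒∈ L odd))))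

  lookup-∪ : ∀ {L K C D} → Unique L → Unique K → (∀ {g} → g ∈ₗ L → g ∉ₗ K) →
             Enumerates L C → Enumerates K D → ∀ g → lookup (C ∪ D) g ≡ parity L g xor parity K g
  lookup-∪ {L} {K} {C} {D} uL uK disjoint enumL enumK g = begin
    lookup (C ∪ D) g          ≡⟨ lookup-zipWith _∨_ g C D ⟩
    lookup C g ∨ lookup D g   ≡⟨ cong₂ _∨_ (lookup-enumerated uL enumL g) (lookup-enumerated uK enumK g) ⟩
    parity L g ∨ parity K g   ≡⟨ ∨≡xor (parity L g) (parity K g) not-both ⟩
    parity L g xor parity K g ∎
    where
    open ≡-Reasoning
    not-both : parity L g ≡ true → parity K g ≡ true → ⊥
    not-both oddL oddK = disjoint (parity≡true⇒∈ L oddL) (parity≡true⇒∈ K oddK)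

  ⟦⟧-enumerates : ∀ {L} → Unique L → Enumerates L ⟦ L ⟧
  ⟦⟧-enumerates {L} u g =
    (λ g∈ → parity≡true⇒∈ L (trans (sym (lookup∘tabulate (parity L) g)) ([]=⇒lookup g∈))) ,
    (λ g∈ → lookup⇒[]= g ⟦ L ⟧ (trans (lookup∘tabulate (parity L) g) (parity-∈ u g∈)))

module Graphs (G : Graph) where
  open Graph G using (n; m)
  open Parity (_≟_ {m})
  open SubsetParity {m}

  private variable
    x y z a b c d : V G
    e f : E G

  joins-sym : Joins G e x y → Joins G e y x
  joins-sym (inj₁ p) = inj₂ p
  joins-sym (inj₂ p) = inj₁ p

  joins-end : Joins G e x y → Joins G e a b → (x ≡ a) ⊎ (x ≡ b)
  joins-end (inj₁ p) (inj₁ q) = inj₁ (cong proj₁ (trans (sym p) q))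
  joins-end (inj₁ p) (inj₂ q) = inj₂ (cong proj₁ (trans (sym p) q))
  joins-end (inj₂ p) (inj₁ q) = inj₂ (cong proj₂ (trans (sym p) q))
  joins-end (inj₂ p) (inj₂ q) = inj₁ (cong proj₂ (trans (sym p) q))

  joins-other : Joins G e x y → Joins G e x z → y ≡ z
  joins-other (inj₁ p) (inj₁ q) = cong proj₂ (trans (sym p) q)
  joins-other (inj₁ p) (inj₂ q) = trans (cong proj₂ (trans (sym p) q)) (cong proj₁ (trans (sym p) q))
  joins-other (inj₂ p) (inj₁ q) = trans (cong proj₁ (trans (sym p) q)) (cong proj₂ (trans (sym p) q))
  joins-other (inj₂ p) (inj₂ q) = cong proj₁ (trans (sym p) q)

  data Walk : V G → V G → Set where
    nil  : Walk x x
    step : (e : E G) → Joins G e x y → Walk y z → Walk x z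

  verts : Walk x y → List (V G)
  verts {x} nil          = x ∷ []
  verts {x} (step e j W) = x ∷ verts W

  edges : Walk x y → List (E G)
  edges nil          = []
  edges (step e j W) = e ∷ edges W

  _++ʷ_ : Walk x y → Walk y z → Walk x z
  nil        ++ʷ B = B
  step e j A ++ʷ B = step e j (A ++ʷ B)

  rev : Walk x y → Walk y x
  rev nil          = nil
  rev (step e j W) = rev W ++ʷ step e (joins-sym j) nil

  start∈ : (W : Walk x y) → x ∈ₗ verts W
  start∈ nil          = here refl
  start∈ (step e j W) = here refl

  end∈ : (W : Walk x y) → y ∈ₗ verts W
  end∈ nil          = here refl
  end∈ (step e j W) = there (end∈ W)

  edge-end∈ : (W : Walk x y) → e ∈ₗ edges W → Joins G e a b → a ∈ₗ verts W
  edge-end∈ (step e j W) (here refl) k with joins-end k j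
  ... | inj₁ refl = here refl
  ... | inj₂ refl = there (start∈ W)
  edge-end∈ (step e j W) (there e∈) k = there (edge-end∈ W e∈ k)

  edges-++ : (A : Walk x y) (B : Walk y z) → edges (A ++ʷ B) ≡ edges A ++ edges B
  edges-++ nil          B = refl
  edges-++ (step e j A) B = cong (e ∷_) (edges-++ A B)

  verts-++⁻ : (A : Walk x y) (B : Walk y z) → a ∈ₗ verts (A ++ʷ B) → a ∈ₗ verts A ⊎ a ∈ₗ verts B
  verts-++⁻ nil          B a∈         = inj₂ a∈
  verts-++⁻ (step e j A) B (here p)   = inj₁ (here p)
  verts-++⁻ (step e j A) B (there a∈) with verts-++⁻ A B a∈
  ... | inj₁ a∈A = inj₁ (there a∈A)
  ... | inj₂ a∈B = inj₂ a∈B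

  verts-snoc : (W : Walk x y) (j : Joins G e y z) → verts (W ++ʷ step e j nil) ≡ verts W ∷ʳ z
  verts-snoc nil          j = refl
  verts-snoc (step f k W) j = cong (_ ∷_) (verts-snoc W j)

  verts-rev : (W : Walk x y) → verts (rev W) ≡ reverse (verts W)
  verts-rev nil = refl
  verts-rev {x} (step e j W) = begin
    verts (rev W ++ʷ step e (joins-sym j) nil) ≡⟨ verts-snoc (rev W) (joins-sym j) ⟩
    verts (rev W) ∷ʳ x                         ≡⟨ cong (_∷ʳ x) (verts-rev W) ⟩
    reverse (verts W) ∷ʳ x                     ≡⟨ sym (unfold-reverse x (verts W)) ⟩
    reverse (x ∷ verts W)                      ∎
    where open ≡-Reasoning

  ∈-verts-rev : (W : Walk x y) → a ∈ₗ verts (rev W) → a ∈ₗ verts W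
  ∈-verts-rev W a∈ = reverse⁻ (subst (_ ∈ₗ_) (verts-rev W) a∈)

  edges-rev : (W : Walk x y) → edges (rev W) ≡ reverse (edges W)
  edges-rev nil = refl
  edges-rev (step e j W) = begin
    edges (rev W ++ʷ step e (joins-sym j) nil) ≡⟨ edges-++ (rev W) (step e (joins-sym j) nil) ⟩
    edges (rev W) ∷ʳ e                         ≡⟨ cong (_∷ʳ e) (edges-rev W) ⟩
    reverse (edges W) ∷ʳ e                     ≡⟨ sym (unfold-reverse e (edges W)) ⟩
    reverse (e ∷ edges W)                      ∎
    where open ≡-Reasoning

  Simple : Walk x y → Set
  Simple nil              = ⊤
  Simple {x} (step e j W) = x ∉ₗ verts W × Simple W

  simple⇒unique-edges : (W : Walk x y) → Simple W → Unique (edges W)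
  simple⇒unique-edges nil          _          = []
  simple⇒unique-edges (step e j W) (x∉ , sW) =
    ¬Any⇒All¬ (edges W) (λ e∈ → x∉ (edge-end∈ W e∈ j)) ∷ simple⇒unique-edges W sW

  closed-simple : (W : Walk x x) → Simple W → edges W ≡ []
  closed-simple nil          _        = refl
  closed-simple (step e j W) (x∉ , _) = ⊥-elim (x∉ (end∈ W))

  simple-++ : (A : Walk x y) (B : Walk y z) → Simple A → Simple B →
              (∀ {a} → a ∈ₗ verts A → a ∈ₗ verts B → a ≡ y) → Simple (A ++ʷ B)
  simple-++ nil          B _          sB meet = sB
  simple-++ {x} (step e j A) B (x∉ , sA) sB meet =
    x∉A++B , simple-++ A B sA sB (λ a∈A a∈B → meet (there a∈A) a∈B)
    where
    x∉A++B : x ∉ₗ verts (A ++ʷ B)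
    x∉A++B x∈ with verts-++⁻ A B x∈
    ... | inj₁ x∈A = x∉ x∈A
    ... | inj₂ x∈B with meet (here refl) x∈B
    ...   | refl = x∉ (end∈ A)

  simple-rev : (W : Walk x y) → Simple W → Simple (rev W)
  simple-rev nil _ = tt
  simple-rev {x} (step {y = y} e j W) (x∉ , sW) =
    simple-++ (rev W) (step e (joins-sym j) nil) (simple-rev W sW) (y∉ , tt) meet
    where
    y∉ : y ∉ₗ x ∷ []
    y∉ (here refl) = x∉ (start∈ W)
    meet : a ∈ₗ verts (rev W) → a ∈ₗ y ∷ x ∷ [] → a ≡ y
    meet a∈ (here a≡y)          = a≡y
    meet a∈ (there (here refl)) = ⊥-elim (x∉ (∈-verts-rev W a∈))

  length : Walk x y → ℕ
  length nil          = 0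
  length (step e j W) = suc (length W)

  vertexAt : (W : Walk x y) → Fin (suc (length W)) → V G
  vertexAt {x} nil          zero    = x
  vertexAt {x} (step e j W) zero    = x
  vertexAt     (step e j W) (suc i) = vertexAt W i

  edgeAt : (W : Walk x y) → Fin (length W) → E G
  edgeAt (step e j W) zero    = e
  edgeAt (step e j W) (suc i) = edgeAt W i

  vertexAt-first : (W : Walk x y) → vertexAt W zero ≡ x
  vertexAt-first nil          = refl
  vertexAt-first (step e j W) = refl

  vertexAt-last : (W : Walk x y) → vertexAt W (fromℕ (length W)) ≡ y
  vertexAt-last nil          = refl
  vertexAt-last (step e j W) = vertexAt-last W

  edgeAt-joins : (W : Walk x y) → ∀ i → Joins G (edgeAt W i) (vertexAt W (inject₁ i)) (vertexAt W (suc i))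
  edgeAt-joins (step e j W) zero    = subst (Joins G e _) (sym (vertexAt-first W)) j
  edgeAt-joins (step e j W) (suc i) = edgeAt-joins W i

  vertexAt∈ : (W : Walk x y) → ∀ i → vertexAt W i ∈ₗ verts W
  vertexAt∈ nil          zero    = here refl
  vertexAt∈ (step e j W) zero    = here refl
  vertexAt∈ (step e j W) (suc i) = there (vertexAt∈ W i)

  edgeAt∈ : (W : Walk x y) → ∀ i → edgeAt W i ∈ₗ edges W
  edgeAt∈ (step e j W) zero    = here refl
  edgeAt∈ (step e j W) (suc i) = there (edgeAt∈ W i)

  ∈⇒edgeAt : (W : Walk x y) → f ∈ₗ edges W → ∃ λ i → edgeAt W i ≡ f
  ∈⇒edgeAt (step e j W) (here refl) = zero , refl
  ∈⇒edgeAt (step e j W) (there f∈) with ∈⇒edgeAt W f∈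
  ... | i , eq = suc i , eq

  vertexAt-injective : (W : Walk x y) → Simple W → ∀ {i k} → vertexAt W i ≡ vertexAt W k → i ≡ k
  vertexAt-injective nil          _         {zero}  {zero}  _  = refl
  vertexAt-injective (step e j W) _         {zero}  {zero}  _  = refl
  vertexAt-injective (step e j W) (x∉ , _)  {zero}  {suc k} eq =
    ⊥-elim (x∉ (subst (_∈ₗ verts W) (sym eq) (vertexAt∈ W k)))
  vertexAt-injective (step e j W) (x∉ , _)  {suc i} {zero}  eq =
    ⊥-elim (x∉ (subst (_∈ₗ verts W) eq (vertexAt∈ W i)))
  vertexAt-injective (step e j W) (_ , sW)  {suc i} {suc k} eq = cong suc (vertexAt-injective W sW eq)

  edgeAt-injective : (W : Walk x y) → Unique (edges W) → ∀ {i k} → edgeAt W i ≡ edgeAt W k → i ≡ k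
  edgeAt-injective (step e j W) _         {zero}  {zero}  _  = refl
  edgeAt-injective (step e j W) (e∉ ∷ _)  {zero}  {suc k} eq =
    ⊥-elim (All¬⇒¬Any e∉ (subst (_∈ₗ edges W) (sym eq) (edgeAt∈ W k)))
  edgeAt-injective (step e j W) (e∉ ∷ _)  {suc i} {zero}  eq =
    ⊥-elim (All¬⇒¬Any e∉ (subst (_∈ₗ edges W) eq (edgeAt∈ W i)))
  edgeAt-injective (step e j W) (_ ∷ uW)  {suc i} {suc k} eq = cong suc (edgeAt-injective W uW eq)

  cycle-of-walk : (W : Walk x y) → Simple W → (j : Joins G e y x) → e ∉ₗ edges W →
                  ∀ {C} → Enumerates (e ∷ edges W) C → IsCycle G C
  cycle-of-walk {x} {y} {e} W sW j e∉ {C} enum = closedWalk , edgesAre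
    where
    Wᶜ : Walk y y
    Wᶜ = step e j W
    -- y is the last vertex of W, so it does not recur among W's earlier vertices
    first-vertices-distinct : ∀ {i k} → vertexAt Wᶜ (inject₁ i) ≡ vertexAt Wᶜ (inject₁ k) → i ≡ k
    first-vertices-distinct {zero}  {zero}  _  = refl
    first-vertices-distinct {zero}  {suc k} eq =
      ⊥-elim (fromℕ≢inject₁ (vertexAt-injective W sW (trans (vertexAt-last W) eq)))
    first-vertices-distinct {suc i} {zero}  eq =
      ⊥-elim (fromℕ≢inject₁ (vertexAt-injective W sW (trans (vertexAt-last W) (sym eq))))
    first-vertices-distinct {suc i} {suc k} eq =
      cong suc (inject₁-injective (vertexAt-injective W sW eq))
    closedWalk : CycleWalk G
    closedWalk = record
      { len₋₁   = length W
      ; vtx     = vertexAt Wᶜ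
      ; edg     = edgeAt Wᶜ
      ; vtx-inj = first-vertices-distinct
      ; closed  = vertexAt-last W
      ; edg-inj = edgeAt-injective Wᶜ (¬Any⇒All¬ (edges W) e∉ ∷ simple⇒unique-edges W sW)
      ; joins   = edgeAt-joins Wᶜ }
    edgesAre : EdgesAre G C (edgeAt Wᶜ)
    edgesAre g = (λ g∈C → ∈⇒edgeAt Wᶜ (proj₁ (enum g) g∈C)) ,
                 (λ { (i , refl) → proj₂ (enum g) (edgeAt∈ Wᶜ i) })

  union-is-cycle : ∀ {u v} → ¬ u ≡ v → (A D : Walk u v) → Simple A → Simple D →
                   (∀ {g} → g ∈ₗ edges A → g ∉ₗ edges D) →
                   (∀ {a} → a ∈ₗ verts A → a ∈ₗ verts D → (a ≡ u) ⊎ (a ≡ v)) →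
                   ∀ {E₁ E₂} → Enumerates (edges A) E₁ → Enumerates (edges D) E₂ →
                   IsCycle G (E₁ ∪ E₂)
  union-is-cycle u≢v A nil _ _ _ _ _ _ = ⊥-elim (u≢v refl)
  union-is-cycle {u} {v} u≢v A (step e j R) sA sD edge-disjoint meet enum₁ enum₂ =
    cycle-of-walk W sW (joins-sym j) e∉W (Enumerates-↭ same-edges (Enumerates-++ enum₁ enum₂))
    where
    W : Walk u _
    W = A ++ʷ rev R
    u∉R = proj₁ sD
    e∉R = Unique[x∷xs]⇒x∉xs (simple⇒unique-edges (step e j R) sD)
    sW : Simple W
    sW = simple-++ A (rev R) sA (simple-rev R (proj₂ sD)) meet-at-v
      where
      meet-at-v : a ∈ₗ verts A → a ∈ₗ verts (rev R) → a ≡ v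
      meet-at-v a∈A a∈rev with meet a∈A (there (∈-verts-rev R a∈rev))
      ... | inj₁ refl = ⊥-elim (u∉R (∈-verts-rev R a∈rev))
      ... | inj₂ a≡v  = a≡v
    edges-W : edges W ≡ edges A ++ reverse (edges R)
    edges-W = trans (edges-++ A (rev R)) (cong (edges A ++_) (edges-rev R))
    e∉W : e ∉ₗ edges W
    e∉W e∈ with ∈-++⁻ (edges A) (subst (e ∈ₗ_) edges-W e∈)
    ... | inj₁ e∈A   = edge-disjoint e∈A (here refl)
    ... | inj₂ e∈rev = e∉R (reverse⁻ e∈rev)
    same-edges : edges A ++ e ∷ edges R ↭ e ∷ edges W
    same-edges = ↭-trans (++⁺ˡ (edges A) (prep e (↭-sym (↭-reverse (edges R)))))
                         (subst (λ L → edges A ++ e ∷ reverse (edges R) ↭ e ∷ L) (sym edges-W)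
                                (shift e (edges A) (reverse (edges R))))

  traced : ∀ k (vt : Fin (suc k) → V G) (ed : Fin k → E G) →
           (∀ i → Joins G (ed i) (vt (inject₁ i)) (vt (suc i))) → Walk (vt zero) (vt (fromℕ k))
  traced zero    vt ed js = nil
  traced (suc k) vt ed js = step (ed zero) (js zero) (traced k (vt ∘ suc) (ed ∘ suc) (js ∘ suc))

  traced-verts : ∀ k vt ed js → a ∈ₗ verts (traced k vt ed js) → ∃ λ i → vt i ≡ a
  traced-verts zero    vt ed js (here refl) = zero , refl
  traced-verts (suc k) vt ed js (here refl) = zero , refl
  traced-verts (suc k) vt ed js (there a∈) with traced-verts k (vt ∘ suc) (ed ∘ suc) (js ∘ suc) a∈
  ... | i , eq = suc i , eq

  traced-edges⁻ : ∀ k vt ed js → f ∈ₗ edges (traced k vt ed js) → ∃ λ i → ed i ≡ f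
  traced-edges⁻ (suc k) vt ed js (here refl) = zero , refl
  traced-edges⁻ (suc k) vt ed js (there f∈) with traced-edges⁻ k (vt ∘ suc) (ed ∘ suc) (js ∘ suc) f∈
  ... | i , eq = suc i , eq

  traced-edges⁺ : ∀ k vt ed js i → ed i ∈ₗ edges (traced k vt ed js)
  traced-edges⁺ (suc k) vt ed js zero    = here refl
  traced-edges⁺ (suc k) vt ed js (suc i) = there (traced-edges⁺ k (vt ∘ suc) (ed ∘ suc) (js ∘ suc) i)

  traced-simple : ∀ k vt ed js → (∀ {i l} → vt i ≡ vt l → i ≡ l) → Simple (traced k vt ed js)
  traced-simple zero    vt ed js vt-inj = tt
  traced-simple (suc k) vt ed js vt-inj =
    (λ a∈ → first-not-later (traced-verts k (vt ∘ suc) (ed ∘ suc) (js ∘ suc) a∈)) ,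
    traced-simple k (vt ∘ suc) (ed ∘ suc) (js ∘ suc) (λ eq → suc-injective (vt-inj eq))
    where
    first-not-later : ¬ (∃ λ i → vt (suc i) ≡ vt zero)
    first-not-later (i , eq) with vt-inj eq
    ... | ()

  retarget : a ≡ c → b ≡ d → (W : Walk a b) →
             Σ (Walk c d) λ W' → verts W' ≡ verts W × edges W' ≡ edges W × (Simple W → Simple W')
  retarget refl refl W = W , refl , refl , λ sW → sW

  record PathWalk {u v} (P : Path G u v) : Set where
    field
      walk           : Walk u v
      simple         : Simple walk
      vertex-on-path : a ∈ₗ verts walk → OnPath G P a
      edge-of-path   : f ∈ₗ edges walk → ∃ λ i → Path.edg P i ≡ f
      path-edge      : ∀ i → Path.edg P i ∈ₗ edges walk

  pathWalk : ∀ {u v} (P : Path G u v) → PathWalk P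
  pathWalk P with retarget (Path.start P) (Path.end P) (traced len vtx edg joins)
    where open Path P
  ... | W , verts≡ , edges≡ , simple≡ = record
    { walk           = W
    ; simple         = simple≡ (traced-simple len vtx edg joins vtx-inj)
    ; vertex-on-path = λ a∈ → traced-verts len vtx edg joins (subst (_ ∈ₗ_) verts≡ a∈)
    ; edge-of-path   = λ f∈ → traced-edges⁻ len vtx edg joins (subst (_ ∈ₗ_) edges≡ f∈)
    ; path-edge      = λ i → subst (_ ∈ₗ_) (sym edges≡) (traced-edges⁺ len vtx edg joins i) }
    where open Path P

  pathWalk-enumerates : ∀ {u v} (P : Path G u v) {E} → PathEdges G P E →
                        Enumerates (edges (PathWalk.walk (pathWalk P))) E
  pathWalk-enumerates P {E} pe g =
    (λ g∈E → path-edge' (proj₁ (pe g) g∈E)) , (λ g∈ → proj₂ (pe g) (edge-of-path g∈))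
    where
    open PathWalk (pathWalk P)
    path-edge' : (∃ λ i → Path.edg P i ≡ g) → g ∈ₗ edges walk
    path-edge' (i , refl) = path-edge i

  record Split (S : Walk x z) (d : V G) : Set where
    field
      before        : Walk x d
      after         : Walk d z
      edges-split   : edges S ≡ edges before ++ edges after
      before-verts  : a ∈ₗ verts before → a ∈ₗ verts S
      before-simple : Simple before
      after-simple  : Simple after

  split : (S : Walk x z) → Simple S → d ∈ₗ verts S → Split S d
  split nil _ (here refl) = record
    { before = nil ; after = nil ; edges-split = refl
    ; before-verts = λ a∈ → a∈ ; before-simple = tt ; after-simple = tt }
  split (step e j S) sS (here refl) = record
    { before = nil ; after = step e j S ; edges-split = refl
    ; before-verts = λ { (here a≡) → here a≡ ; (there ()) } ; before-simple = tt ; after-simple = sS }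
  split (step e j S) (x∉ , sS) (there d∈) = record
    { before        = step e j before
    ; after         = after
    ; edges-split   = cong (e ∷_) edges-split
    ; before-verts  = λ { (here a≡) → here a≡ ; (there a∈) → there (before-verts a∈) }
    ; before-simple = (λ x∈ → x∉ (before-verts x∈)) , before-simple
    ; after-simple  = after-simple }
    where open Split (split S sS d∈)

  module Forest (T : EdgeSet G) (acyclic : ∀ C → IsCycle G C → ¬ (C ⊆ T)) where
    open import Data.List.Membership.DecPropositional (_≟_ {n}) using () renaming (_∈?_ to _∈ᵛ?_)
    open import Data.List.Membership.DecPropositional (_≟_ {m}) using () renaming (_∈?_ to _∈ᵉ?_)

    InT : Walk x y → Set
    InT W = ∀ {f} → f ∈ₗ edges W → f ∈ T

    -- A simple walk S from c to d closed by an edge e joining d and c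
    -- either avoids e, and then S + e is a cycle, or S is the single edge e.
    retraces : (S : Walk c d) → Simple S → Joins G e d c → e ∈ₗ edges S → edges S ≡ e ∷ []
    retraces (step f k R) (c∉R , sR) j (here refl) with joins-other (joins-sym j) k
    ... | refl = cong (f ∷_) (closed-simple R sR)
    retraces (step f k R) (c∉R , sR) j (there e∈R) = ⊥-elim (c∉R (edge-end∈ R e∈R (joins-sym j)))

    closing-parity : (S : Walk c d) → Simple S → InT S → e ∈ T → Joins G e d c →
                     ∀ g → parity (e ∷ edges S) g ≡ false
    closing-parity {e = e} S sS S⊆T e∈T j g with e ∈ᵉ? edges S
    ... | yes e∈S rewrite retraces S sS j e∈S = parity-twice e g
    ... | no e∉S  =
      ⊥-elim (acyclic ⟦ e ∷ edges S ⟧ (cycle-of-walk S sS j e∉S (⟦⟧-enumerates unique)) ⊆T)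
      where
      unique : Unique (e ∷ edges S)
      unique = ¬Any⇒All¬ (edges S) e∉S ∷ simple⇒unique-edges S sS
      ⊆T : ⟦ e ∷ edges S ⟧ ⊆ T
      ⊆T {h} h∈ with proj₁ (⟦⟧-enumerates unique h) h∈
      ... | here refl = e∈T
      ... | there h∈S = S⊆T h∈S

    ++-inT : (A : Walk x y) (B : Walk y z) → InT A → InT B → InT (A ++ʷ B)
    ++-inT A B A⊆T B⊆T f∈ with ∈-++⁻ (edges A) (subst (_ ∈ₗ_) (edges-++ A B) f∈)
    ... | inj₁ f∈A = A⊆T f∈A
    ... | inj₂ f∈B = B⊆T f∈B

    -- One step of loop erasure.  If d is new, e is put in front
    -- of S; otherwise the part of S before d is a loop closed by e, and it is
    -- cut off.
    erase-step : (S : Walk c x) → Simple S → InT S → Joins G e c d → e ∈ T →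
                 Σ (Walk d x) λ S' → Simple S' × InT S' ×
                   (∀ g → parity (edges S') g ≡ parity (e ∷ edges S) g)
    erase-step {e = e} {d = d} S sS S⊆T j e∈T with d ∈ᵛ? verts S
    ... | no d∉S = step e (joins-sym j) S , (d∉S , sS) , eS⊆T , λ g → refl
      where
      eS⊆T : InT (step e (joins-sym j) S)
      eS⊆T (here refl) = e∈T
      eS⊆T (there f∈)  = S⊆T f∈
    ... | yes d∈S = after , after-simple , S⊆T' ∘ ∈-++⁺ʳ (edges before) , cut
      where
      open Split (split S sS d∈S)
      S⊆T' : ∀ {f} → f ∈ₗ edges before ++ edges after → f ∈ T
      S⊆T' f∈ = S⊆T (subst (_ ∈ₗ_) (sym edges-split) f∈)
      loop-even : ∀ g → parity (e ∷ edges before) g ≡ false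
      loop-even = closing-parity before before-simple (S⊆T' ∘ ∈-++⁺ˡ) e∈T (joins-sym j)
      cut : ∀ g → parity (edges after) g ≡ parity (e ∷ edges S) g
      cut g = begin
        B                                    ≡⟨ cong (_xor B) (loop-even g) ⟨
        (ε xor F) xor B                      ≡⟨ xor-assoc ε F B ⟩
        ε xor (F xor B)                      ≡⟨ cong (ε xor_) (parity-++ (edges before) (edges after) g) ⟨
        ε xor parity (edges before ++ edges after) g ≡⟨ cong (λ L → ε xor parity L g) edges-split ⟨
        ε xor parity (edges S) g             ∎
        where
        open ≡-Reasoning
        ε = does (e ≟ g)
        F = parity (edges before) g
        B = parity (edges after) g

    erase : (S : Walk c x) → Simple S → InT S → (W : Walk c y) → InT W →
            Σ (Walk y x) λ S' → Simple S' ×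
              (∀ g → parity (edges S') g ≡ parity (edges S) g xor parity (edges W) g)
    erase S sS S⊆T nil _ = S , sS , λ g → sym (xor-identityʳ _)
    erase S sS S⊆T (step e j W) W⊆T with erase-step S sS S⊆T j (W⊆T (here refl))
    ... | S₁ , sS₁ , S₁⊆T , par₁ with erase S₁ sS₁ S₁⊆T W (W⊆T ∘ there)
    ...   | S' , sS' , par' = S' , sS' , λ g → begin
      parity (edges S') g                                    ≡⟨ par' g ⟩
      parity (edges S₁) g xor parity (edges W) g             ≡⟨ cong (_xor parity (edges W) g) (par₁ g) ⟩
      (does (e ≟ g) xor parity (edges S) g) xor parity (edges W) g
        ≡⟨ xy∙z≈y∙xz (does (e ≟ g)) (parity (edges S) g) (parity (edges W) g) ⟩
      parity (edges S) g xor parity (e ∷ edges W) g          ∎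
      where open ≡-Reasoning

    closed-walk-parity : (W : Walk x x) → InT W → ∀ g → parity (edges W) g ≡ false
    closed-walk-parity W W⊆T g with erase nil tt (λ ()) W W⊆T
    ... | S' , sS' , par≡ = begin
      parity (edges W) g  ≡⟨ par≡ g ⟨
      parity (edges S') g ≡⟨ cong (λ L → parity L g) (closed-simple S' sS') ⟩
      false               ∎
      where open ≡-Reasoning

    there-and-back-parity : (A : Walk x y) (B : Walk y x) → InT A → InT B →
                            ∀ g → parity (edges A) g ≡ parity (edges B) g
    there-and-back-parity A B A⊆T B⊆T g = xor≡false⇒≡ _ _ (begin
      parity (edges A) g xor parity (edges B) g ≡⟨ parity-++ (edges A) (edges B) g ⟨
      parity (edges A ++ edges B) g             ≡⟨ cong (λ L → parity L g) (edges-++ A B) ⟨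
      parity (edges (A ++ʷ B)) g                ≡⟨ closed-walk-parity (A ++ʷ B) (++-inT A B A⊆T B⊆T) g ⟩
      false                                     ∎)
      where open ≡-Reasoning

    record TreePath (x y : V G) : Set where
      field
        walk   : Walk x y
        simple : Simple walk
        inT    : InT walk

    treePath : (Σ (Path G x y) λ P → ∀ i → Path.edg P i ∈ T) → TreePath x y
    treePath (P , P⊆T) =
      record { walk = walk ; simple = simple ; inT = λ f∈ → edge∈T (edge-of-path f∈) }
      where
      open PathWalk (pathWalk P)
      edge∈T : (∃ λ i → Path.edg P i ≡ f) → f ∈ T
      edge∈T (i , refl) = P⊆T i

    module Fundamental (tree-path : ∀ x y → TreePath x y) where
      open TreePath

      fundamental : E G → V G → V G → EdgeSet G
      fundamental f x y = ⟦ f ∷ edges (walk (tree-path y x)) ⟧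

      fundamental-cycle : Joins G f x y → f ∉ T → IsFundamentalCycle G T f (fundamental f x y)
      fundamental-cycle {f} {x} {y} j f∉T =
        cycle-of-walk Q sQ j (f∉T ∘ Q⊆T) (⟦⟧-enumerates unique) , ⊆T∪f
        where
        Q   = walk (tree-path y x)
        sQ  = simple (tree-path y x)
        Q⊆T = inT (tree-path y x)
        unique : Unique (f ∷ edges Q)
        unique = ¬Any⇒All¬ (edges Q) (f∉T ∘ Q⊆T) ∷ simple⇒unique-edges Q sQ
        ⊆T∪f : fundamental f x y ⊆ T ∪ ⁅ f ⁆
        ⊆T∪f {g} g∈ with proj₁ (⟦⟧-enumerates unique g) g∈
        ... | here refl = x∈p∪q⁺ (inj₂ (x∈⁅x⁆ f))
        ... | there g∈Q = x∈p∪q⁺ (inj₁ (Q⊆T g∈Q))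

      fundamental-cycles : Walk a b → List (EdgeSet G)
      fundamental-cycles nil                    = []
      fundamental-cycles (step {x} {y} f j W) = fundamental f x y ∷ fundamental-cycles W

      -- The tree paths closing those cycles, composed: a T-walk from b back to a.
      shadow : Walk a b → Walk b a
      shadow nil                    = nil
      shadow (step {x} {y} f j W) = shadow W ++ʷ walk (tree-path y x)

      shadow-inT : (D : Walk a b) → InT (shadow D)
      shadow-inT nil ()
      shadow-inT (step {x} {y} f j W) =
        ++-inT (shadow W) (walk (tree-path y x)) (shadow-inT W) (inT (tree-path y x))

      fundamental-cycles-balanced : (Ω : BiasedGraph G) (D : Walk a b) →
        (∀ {f} → f ∈ₗ edges D → f ∉ T) →
        (∀ {f} → f ∈ₗ edges D → ∀ C → IsFundamentalCycle G T f C → BiasedGraph.Balanced Ω C) →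
        All (BiasedGraph.Balanced Ω) (fundamental-cycles D)
      fundamental-cycles-balanced Ω nil _ _ = []
      fundamental-cycles-balanced Ω (step f j W) D∩T=∅ balanced =
        balanced (here refl) _ (fundamental-cycle j (D∩T=∅ (here refl))) ∷
        fundamental-cycles-balanced Ω W (D∩T=∅ ∘ there) (balanced ∘ there)

      fundamental-cycles-sum : (D : Walk a b) → ∀ g →
        lookup (△-sum G (fundamental-cycles D)) g ≡ parity (edges D) g xor parity (edges (shadow D)) g
      fundamental-cycles-sum nil g = lookup-replicate g false
      fundamental-cycles-sum (step {x} {y} f j W) g = begin
        lookup (△-sum G (fundamental-cycles (step f j W))) g
          ≡⟨ lookup-zipWith _xor_ g (fundamental f x y) rest ⟩
        lookup (fundamental f x y) g xor lookup rest g
          ≡⟨ cong₂ _xor_ (lookup∘tabulate (parity (f ∷ edges Q)) g) (fundamental-cycles-sum W g) ⟩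
        (ε xor q) xor (δ xor s)
          ≡⟨ interchange ε q δ s ⟩
        (ε xor δ) xor (q xor s)
          ≡⟨ cong ((ε xor δ) xor_) (xor-comm q s) ⟩
        (ε xor δ) xor (s xor q)
          ≡⟨ cong ((ε xor δ) xor_) (parity-++ (edges (shadow W)) (edges Q) g) ⟨
        (ε xor δ) xor parity (edges (shadow W) ++ edges Q) g
          ≡⟨ cong (λ L → (ε xor δ) xor parity L g) (edges-++ (shadow W) Q) ⟨
        (ε xor δ) xor parity (edges (shadow W ++ʷ Q)) g
          ∎
        where
        open ≡-Reasoning
        Q    = walk (tree-path y x)
        rest = △-sum G (fundamental-cycles W)
        ε    = does (f ≟ g)
        q    = parity (edges Q) g
        δ    = parity (edges W) g
        s    = parity (edges (shadow W)) g

      -- The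
      -- fundamental cycles of D sum to D + shadow D = D + A = E₁ ∪ E₂.
      theta-balanced : (Ω : BiasedGraph G) → Linear G Ω → ∀ {u v} → ¬ u ≡ v →
        (A D : Walk u v) → Simple A → Simple D → InT A → (∀ {f} → f ∈ₗ edges D → f ∉ T) →
        (∀ {a} → a ∈ₗ verts A → a ∈ₗ verts D → (a ≡ u) ⊎ (a ≡ v)) →
        ∀ {E₁ E₂} → Enumerates (edges A) E₁ → Enumerates (edges D) E₂ →
        (∀ {f} → f ∈ₗ edges D → ∀ C → IsFundamentalCycle G T f C → BiasedGraph.Balanced Ω C) →
        BiasedGraph.Balanced Ω (E₁ ∪ E₂)
      theta-balanced Ω linear u≢v A D sA sD A⊆T D∩T=∅ meet {E₁} {E₂} enum₁ enum₂ balanced =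
        linear (E₁ ∪ E₂) (union-is-cycle u≢v A D sA sD edge-disjoint meet enum₁ enum₂)
          (fundamental-cycles D , fundamental-cycles-balanced Ω D D∩T=∅ balanced ,
           Pointwise-≡⇒≡ (ext sum≡union))
        where
        edge-disjoint : ∀ {g} → g ∈ₗ edges A → g ∉ₗ edges D
        edge-disjoint g∈A g∈D = D∩T=∅ g∈D (A⊆T g∈A)
        sum≡union : ∀ g → lookup (△-sum G (fundamental-cycles D)) g ≡ lookup (E₁ ∪ E₂) g
        sum≡union g = begin
          lookup (△-sum G (fundamental-cycles D)) g ≡⟨ fundamental-cycles-sum D g ⟩
          pD xor parity (edges (shadow D)) g         ≡⟨ cong (pD xor_) A≡shadow ⟨
          pD xor pA                                  ≡⟨ xor-comm pD pA ⟩
          pA xor pD                                  ≡⟨ lookup-∪ (simple⇒unique-edges A sA) (simple⇒unique-edges D sD)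
                                                                 edge-disjoint enum₁ enum₂ g ⟨
          lookup (E₁ ∪ E₂) g                         ∎
          where
          open ≡-Reasoning
          pA = parity (edges A) g
          pD = parity (edges D) g
          -- A goes from u to v inside T, and the shadow of D comes back
          A≡shadow = there-and-back-parity A (shadow D) A⊆T (shadow-inT D) g

lemma3p1 : (G : Graph) (Ω : BiasedGraph G) → Linear G Ω →
    (T : EdgeSet G) → IsSpanningTree G T →
    (u v : V G) → ¬ (u ≡ v) →
    (P₁ P₂ : Path G u v) → (E₁ E₂ : EdgeSet G) →
    PathEdges G P₁ E₁ → PathEdges G P₂ E₂ →
    (∀ x → OnPath G P₁ x → OnPath G P₂ x → (x ≡ u) ⊎ (x ≡ v)) →
    (∀ e → e ∈ E₁ → e ∈ T) →
    (∀ e → e ∈ E₂ → e ∉ T) →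
    (∀ e → e ∈ E₂ → ∀ C → IsFundamentalCycle G T e C → BiasedGraph.Balanced Ω C) →
    BiasedGraph.Balanced Ω (E₁ ∪ E₂)
lemma3p1 G Ω linear T (connected , acyclic) u v u≢v P₁ P₂ E₁ E₂ edges₁ edges₂
         internally-disjoint E₁⊆T E₂∩T=∅ balanced =
  theta-balanced Ω linear u≢v A D (simple W₁) (simple W₂)
    (λ f∈ → E₁⊆T _ (∈E₁ f∈)) (λ f∈ → E₂∩T=∅ _ (∈E₂ f∈))
    (λ a∈A a∈D → internally-disjoint _ (vertex-on-path W₁ a∈A) (vertex-on-path W₂ a∈D))
    enum₁ enum₂ (λ f∈ → balanced _ (∈E₂ f∈))
  where
  open Graphs G
  open Forest T acyclic
  open Fundamental (λ x y → treePath (connected x y))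
  open PathWalk
  W₁ = pathWalk P₁
  W₂ = pathWalk P₂
  A = walk W₁
  D = walk W₂
  enum₁ = pathWalk-enumerates P₁ edges₁
  enum₂ = pathWalk-enumerates P₂ edges₂
  ∈E₁ : ∀ {f} → f ∈ₗ edges A → f ∈ E₁
  ∈E₁ {f} = proj₂ (enum₁ f)
  ∈E₂ : ∀ {f} → f ∈ₗ edges D → f ∈ E₂
  ∈E₂ {f} = proj₂ (enum₂ f)
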